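{- Let $A \subset \mathbb{Z}$ be a finite set in normal form with $|A| \geq 3$, and let $m > 1$ be an integer with $m \mid \max(A)$. If the canonical projection of $A$ into $\mathbb{Z}_m$ is rectifiable, then $\dim(A) \geq 2$.
   Context: A finite set $A \subset \mathbb{Z}$ is in normal form if $A \subset \mathbb{N}_0$, $0 \in A$ and $\gcd(A) = 1$. For subsets $A, B$ of (possibly different) abelian groups, a bijection $f : A \to B$ is a Freiman isomorphism of order $2$ ($F_2$-isomorphism) if for all $a_1, a_2, a_1', a_2' \in A$ we have $a_1 + a_2 = a_1' + a_2'$ if and only if $f(a_1) + f(a_2) = f(a_1') + f(a_2')$. A subset of an abelian group is rectifiable if it is $F_2$-isomorphic to a set of integers. The additive dimension $\dim(A)$ of a finite set $A \subset \mathbb{Z}$ is the largest $s \in \mathbb{N}$ such that $A$ is $F_2$-isomorphic to a subset of $\mathbb{Z}^s$ not contained in an (affine) hyperplane. -}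

module Defs where

open import Data.Nat as ℕ using (ℕ; _⊔_; _%_; NonZero)
open import Data.Nat.GCD using (gcd)
open import Data.Integer as ℤ using (ℤ)
open import Data.List using (List; foldr; length)
open import Data.List.Membership.Propositional using (_∈_)
open import Data.List.Relation.Unary.Unique.Propositional using (Unique)
open import Data.Vec as Vec using (Vec; zipWith; foldr′)
open import Data.Product using (Σ; ∃; _×_)
open import Data.Fin using (Fin)
open import Relation.Binary.PropositionalEquality using (_≡_; _≢_)
open import Relation.Nullary using (¬_)
open import Function.Bundles using (_⇔_)

-- A finite set of integers in normal form, represented as a duplicate-free
-- list of natural numbers (normal form forces A ⊂ ℕ₀), with 0 ∈ A and gcd(A) = 1.
gcdList : List ℕ → ℕ
gcdList = foldr gcd 0

maxList : List ℕ → ℕ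
maxList = foldr _⊔_ 0

record NormalForm (A : List ℕ) : Set where
  field
    unique : Unique A
    zero∈  : 0 ∈ A
    gcd≡1  : gcdList A ≡ 1

-- Rectifiability of the canonical projection π_m(A) = { a mod m : a ∈ A } ⊂ ℤ_m:
-- there is a map g : ℤ_m → ℤ (residues represented by ℕ below m) which is an
-- F₂-isomorphism from π_m(A) onto its image g(π_m(A)) ⊂ ℤ.
-- Quantifying over a₁,a₂,a₁',a₂' ∈ A is the same as quantifying over their residues.
ProjRectifiable : (m : ℕ) .{{_ : NonZero m}} → List ℕ → Set
ProjRectifiable m A =
  Σ (ℕ → ℤ) λ g →
    (∀ {a b} → a ∈ A → b ∈ A → g (a % m) ≡ g (b % m) → a % m ≡ b % m)
    × (∀ {a₁ a₂ b₁ b₂} → a₁ ∈ A → a₂ ∈ A → b₁ ∈ A → b₂ ∈ A →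
        (((a₁ ℕ.+ a₂) % m ≡ (b₁ ℕ.+ b₂) % m)
          ⇔ (g (a₁ % m) ℤ.+ g (a₂ % m) ≡ g (b₁ % m) ℤ.+ g (b₂ % m))))

_⊕_ : ∀ {s} → Vec ℤ s → Vec ℤ s → Vec ℤ s
_⊕_ = zipWith ℤ._+_

dot : ∀ {s} → Vec ℤ s → Vec ℤ s → ℤ
dot u v = foldr′ ℤ._+_ (ℤ.+ 0) (zipWith ℤ._*_ u v)

F₂IsoInto : ∀ {s} → List ℕ → (ℕ → Vec ℤ s) → Set
F₂IsoInto A φ =
  (∀ {a b} → a ∈ A → b ∈ A → φ a ≡ φ b → a ≡ b)
  × (∀ {a₁ a₂ b₁ b₂} → a₁ ∈ A → a₂ ∈ A → b₁ ∈ A → b₂ ∈ A →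
      ((a₁ ℕ.+ a₂ ≡ b₁ ℕ.+ b₂) ⇔ (φ a₁ ⊕ φ a₂ ≡ φ b₁ ⊕ φ b₂)))

NotInHyperplane : ∀ {s} → List ℕ → (ℕ → Vec ℤ s) → Set
NotInHyperplane {s} A φ =
  (c : Vec ℤ s) → c ≢ Vec.replicate s (ℤ.+ 0) → (d : ℤ) →
    ¬ (∀ {a} → a ∈ A → dot c (φ a) ≡ d)

-- dim(A) ≥ s₀ : A is F₂-isomorphic to a subset of ℤ^s, not contained in a
-- hyperplane, for some s ≥ s₀ (equivalently the largest such s is ≥ s₀).
DimAtLeast : ℕ → List ℕ → Set
DimAtLeast s₀ A =
  ∃ λ s → s₀ ℕ.≤ s × Σ (ℕ → Vec ℤ s) λ φ → F₂IsoInto A φ × NotInHyperplane A φ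

module Submission where

open import Defs
open import Data.Nat using (ℕ; _≤_; _<_; NonZero)
open import Data.Nat.Divisibility using (_∣_)
open import Data.List using (List; length)

open import Data.Nat as ℕ using (_%_)
import Data.Nat.Properties as ℕP
open import Data.Nat.Divisibility using (_∣0; ∣1⇒≡1; m%n≡0⇒n∣m; n∣m⇒m%n≡0)
open import Data.Nat.GCD using (gcd; gcd-greatest; gcd[0,0]≡0)
open import Data.Integer as ℤ using (ℤ; +_; 0ℤ)
import Data.Integer.Properties as ℤP
open import Algebra.Properties.AbelianGroup ℤP.+-0-abelianGroup using (∙-cancelʳ)
open import Data.List using ([]; _∷_)
open import Data.List.Membership.Propositional using (_∈_)
open import Data.List.Membership.Propositional.Properties using (foldr-selective)
open import Data.List.Relation.Unary.Any using (here; there)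
open import Data.Vec using (Vec; []; _∷_; head)
open import Data.Product using (_,_)
open import Data.Sum using (_⊎_; inj₁; inj₂)
open import Data.Empty using (⊥-elim)
open import Relation.Nullary using (¬_)
open import Relation.Binary.PropositionalEquality
open import Function.Base using (_∘_)
open import Function.Bundles using (mk⇔; Equivalence)

-- Let g rectify π_m(A) and embed A into ℤ² by a ↦ (a, g(a mod m)). The first
-- coordinate alone already makes this an F₂-isomorphism. If the image lay on a
-- line c₁x + c₂y = d, comparing 0 with M = max A (both ≡ 0 mod m) gives c₁M = 0,
-- so c₁ = 0 and a ↦ g(a mod m) is constant on A; injectivity of g then puts
-- all of A in mℤ, against gcd(A) = 1.

maxList∈ : ∀ A → maxList A ≡ 0 ⊎ maxList A ∈ A
maxList∈ = foldr-selective ℕP.⊔-sel 0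

maxList≡0⇒gcdList≡0 : ∀ A → maxList A ≡ 0 → gcdList A ≡ 0
maxList≡0⇒gcdList≡0 []       _  = refl
maxList≡0⇒gcdList≡0 (a ∷ as) eq = trans
  (cong₂ gcd (bounded-by-0 (ℕP.m≤m⊔n a (maxList as)))
             (maxList≡0⇒gcdList≡0 as (bounded-by-0 (ℕP.m≤n⊔m a (maxList as)))))
  gcd[0,0]≡0
  where
  bounded-by-0 : ∀ {n} → n ≤ a ℕ.⊔ maxList as → n ≡ 0
  bounded-by-0 n≤ = ℕP.n≤0⇒n≡0 (subst (_ ≤_) eq n≤)

∣gcdList : ∀ {m} A → (∀ {a} → a ∈ A → m ∣ a) → m ∣ gcdList A
∣gcdList []       _   = _ ∣0
∣gcdList (a ∷ as) m∣A = gcd-greatest (m∣A (here refl)) (∣gcdList as (m∣A ∘ there))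

module NormalFormProperties {A : List ℕ} (nf : NormalForm A) where
  open NormalForm nf

  maxList≢0 : maxList A ≢ 0
  maxList≢0 eq with trans (sym gcd≡1) (maxList≡0⇒gcdList≡0 A eq)
  ... | ()

  maxList∈A : maxList A ∈ A
  maxList∈A with maxList∈ A
  ... | inj₁ eq = ⊥-elim (maxList≢0 eq)
  ... | inj₂ p  = p

  common-divisor≡1 : ∀ {m} → (∀ {a} → a ∈ A → m ∣ a) → m ≡ 1
  common-divisor≡1 m∣A = ∣1⇒≡1 (subst (_ ∣_) gcd≡1 (∣gcdList A m∣A))

graph : (ℕ → ℤ) → ℕ → Vec ℤ 2
graph h a = + a ∷ h a ∷ []

graph-F₂IsoInto : ∀ {A} (h : ℕ → ℤ) →
  (∀ {a₁ a₂ b₁ b₂} → a₁ ∈ A → a₂ ∈ A → b₁ ∈ A → b₂ ∈ A →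
    a₁ ℕ.+ a₂ ≡ b₁ ℕ.+ b₂ → h a₁ ℤ.+ h a₂ ≡ h b₁ ℤ.+ h b₂) →
  F₂IsoInto A (graph h)
graph-F₂IsoInto h h-sum =
  (λ _ _ → ℤP.+-injective ∘ cong head) ,
  (λ p₁ p₂ q₁ q₂ → mk⇔
    (λ eq → cong₂ (λ x y → x ∷ y ∷ []) (cong +_ eq) (h-sum p₁ p₂ q₁ q₂ eq))
    (ℤP.+-injective ∘ cong head))

dot-graph : ∀ c₁ c₂ h a → dot (c₁ ∷ c₂ ∷ []) (graph h a) ≡ c₁ ℤ.* + a ℤ.+ c₂ ℤ.* h a
dot-graph c₁ c₂ h a = cong (ℤ._+_ (c₁ ℤ.* + a)) (ℤP.+-identityʳ (c₂ ℤ.* h a))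

graph-NotInHyperplane : ∀ {A M} (h : ℕ → ℤ) → 0 ∈ A → M ∈ A → M ≢ 0 →
  h M ≡ h 0 → ¬ (∀ {a} → a ∈ A → h a ≡ h 0) → NotInHyperplane A (graph h)
graph-NotInHyperplane {A} {M} h 0∈A M∈A M≢0 hM≡h0 h-nonconst (c₁ ∷ c₂ ∷ []) c≢0 d onLine =
  h-nonconst (λ p → ℤP.*-cancelˡ-≡ c₂ _ _ {{ℤ.≢-nonZero c₂≢0}} (c₂h≡c₂h0 p))
  where
  line : ∀ {a} → a ∈ A → c₁ ℤ.* + a ℤ.+ c₂ ℤ.* h a ≡ d
  line {a} p = trans (sym (dot-graph c₁ c₂ h a)) (onLine p)

  c₁M≡0 : c₁ ℤ.* + M ≡ 0ℤ
  c₁M≡0 = ∙-cancelʳ (c₂ ℤ.* h M) _ _ (begin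
    c₁ ℤ.* + M ℤ.+ c₂ ℤ.* h M  ≡⟨ trans (line M∈A) (sym (line 0∈A)) ⟩
    c₁ ℤ.* + 0 ℤ.+ c₂ ℤ.* h 0  ≡⟨ cong₂ ℤ._+_ (ℤP.*-zeroʳ c₁) (cong (c₂ ℤ.*_) (sym hM≡h0)) ⟩
    0ℤ ℤ.+ c₂ ℤ.* h M          ∎)
    where open ≡-Reasoning

  c₁≡0 : c₁ ≡ 0ℤ
  c₁≡0 with ℤP.i*j≡0⇒i≡0∨j≡0 c₁ c₁M≡0
  ... | inj₁ eq = eq
  ... | inj₂ eq = ⊥-elim (M≢0 (ℤP.+-injective eq))

  c₂≢0 : c₂ ≢ 0ℤ
  c₂≢0 eq = c≢0 (cong₂ (λ x y → x ∷ y ∷ []) c₁≡0 eq)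

  c₂h : ∀ {a} → a ∈ A → c₂ ℤ.* h a ≡ d
  c₂h {a} p = begin
    c₂ ℤ.* h a                  ≡⟨ sym (ℤP.+-identityˡ _) ⟩
    0ℤ ℤ.+ c₂ ℤ.* h a           ≡⟨ cong (λ c → c ℤ.* + a ℤ.+ c₂ ℤ.* h a) (sym c₁≡0) ⟩
    c₁ ℤ.* + a ℤ.+ c₂ ℤ.* h a   ≡⟨ line p ⟩
    d                           ∎
    where open ≡-Reasoning

  c₂h≡c₂h0 : ∀ {a} → a ∈ A → c₂ ℤ.* h a ≡ c₂ ℤ.* h 0
  c₂h≡c₂h0 p = trans (c₂h p) (sym (c₂h 0∈A))

lemma2p2 : (A : List ℕ) → NormalForm A → 3 ≤ length A →
    (m : ℕ) → .{{_ : NonZero m}} → 1 < m → m ∣ maxList A →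
    ProjRectifiable m A → DimAtLeast 2 A
lemma2p2 A nf _ m 1<m m∣M (g , g-inj , g-sum) =
  2 , ℕP.≤-refl , graph h ,
  graph-F₂IsoInto h (λ p₁ p₂ q₁ q₂ eq → Equivalence.to (g-sum p₁ p₂ q₁ q₂) (cong (_% m) eq)) ,
  graph-NotInHyperplane h zero∈ maxList∈A maxList≢0 hM≡h0 h-nonconst
  where
  open NormalForm nf
  open NormalFormProperties nf

  h : ℕ → ℤ
  h a = g (a % m)

  0%m≡0 : 0 % m ≡ 0
  0%m≡0 = n∣m⇒m%n≡0 0 m (m ∣0)

  hM≡h0 : h (maxList A) ≡ h 0
  hM≡h0 = cong g (trans (n∣m⇒m%n≡0 _ m m∣M) (sym 0%m≡0))

  h-nonconst : ¬ (∀ {a} → a ∈ A → h a ≡ h 0)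
  h-nonconst h-const = ℕP.>⇒≢ 1<m (common-divisor≡1 λ {a} p →
    m%n≡0⇒n∣m a m (trans (g-inj p zero∈ (h-const p)) 0%m≡0))
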